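{- In the canonical model $M(T_0,F_0)$, for any worlds $w,u\in W$ and any formula ${\sf B}^T_X\phi\in F(w)$, if $w\sim_X u$ and $T\subseteq\mathcal{T}_u$, then $\phi\in F(u)$.
   Context: Fix a set $V$ of data variables and a set of atomic propositions. The language $\Phi$ is generated by $\phi::=p\mid\neg\phi\mid\phi\to\phi\mid{\sf B}^T_X\phi\mid[X]\phi$, with $p$ atomic and $X,T\subseteq V$. Proof system: axioms are all propositional tautologies in $\Phi$ and all instances (arbitrary datasets $X,Y,T,T',X'$, formulae $\phi,\psi$) of Truth ${\sf B}^\varnothing_X\phi\to\phi$; Distributivity ${\sf B}^T_X(\phi\to\psi)\to({\sf B}^T_X\phi\to{\sf B}^T_X\psi)$ and $[X](\phi\to\psi)\to([X]\phi\to[X]\psi)$; Negative Introspection $\neg{\sf B}^T_X\phi\to{\sf B}^\varnothing_X\neg{\sf B}^T_X\phi$; Monotonicity ${\sf B}^T_X\phi\to{\sf B}^{T'}_{X'}\phi$ for $T\subseteq T'$, $X\subseteq X'$; Trust ${\sf B}^T_X({\sf B}^T_Y\phi\to\phi)$; Combination $[X][Y]\phi\leftrightarrow[X\cup Y]\phi$; Commutativity $[Y]{\sf B}^T_X\phi\leftrightarrow{\sf B}^T_{Y\cup X}[Y]\phi$; Duality $\neg[X]\phi\leftrightarrow[X]\neg\phi$; Empty Announcement $[\varnothing]\phi\leftrightarrow\phi$. Rules: Modus Ponens and Necessitation (from $\phi$ infer ${\sf B}^T_X\phi$ and $[X]\phi$). Theorems are formulae derivable this way; $F\vdash\phi$ means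 $\phi$ is derivable from the theorems and $F$ by Modus Ponens only. $F$ is inconsistent if $F\vdash\phi$ and $F\vdash\neg\phi$ for some $\phi$; maximal consistent sets are consistent sets with no proper consistent superset. Canonical model $M(T_0,F_0)$, for a dataset $T_0\subseteq V$ and a maximal consistent set $F_0$: the set $W$ of worlds consists of all finite sequences $T_0,F_0,X_1,T_1,F_1,\dots,X_n,T_n,F_n$ ($n\ge0$) such that for each $0\le i\le n$: $X_i,T_i\subseteq V$ are datasets, and $F_i$ is a maximal consistent set with (a) if $i>0$, $\psi\in F_i$ for every formula ${\sf B}^\varnothing_{X_i}\psi\in F_{i-1}$, and (b) ${\sf B}^{T_i}_Y\phi\to\phi\in F_i$ for every dataset $Y$ and formula $\phi$. For a world $w$ ending in $X_n,T_n,F_n$ (or $T_0,F_0$ if $n=0$), $T(w)=T_n$ and $F(w)=F_n$. Worlds $w'=T_0,\dots,F_{n-1}$ and $w=T_0,\dots,F_{n-1},X_n,T_n,F_n$ are adjacent, and this edge is labelled by the variables in $X_n$; adjacency forms a tree on $W$. For $x\in V$, $u\sim_x v$ iff every edge along the unique simple path between $u$ and $v$ is labelled with $x$; $u\sim_X v$ iff $u\sim_x v$ for all $x\in X$. $\mathcal{T}_w=T(w)$, and $\pi(p)=\{(w,U)\in W\times\mathcal{P}(V)\mid[U]p\in F(w)\}$. -}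

module Defs where

open import Level using (Level; 0ℓ)
open import Data.Bool using (Bool; true; false; not; _∨_)
open import Data.Empty using (⊥)
open import Data.Sum using (_⊎_)
open import Data.Product using (Σ; ∃; _×_; _,_)
open import Data.List using (List; []; _∷_; _++_)
open import Data.List.Relation.Unary.All using (All)
open import Relation.Binary.PropositionalEquality using (_≡_)
open import Relation.Nullary using (¬_)

Dataset : Set → Set₁
Dataset V = V → Set

∅ : {V : Set} → Dataset V
∅ = λ _ → ⊥

_∪_ : {V : Set} → Dataset V → Dataset V → Dataset V
(X ∪ Y) = λ x → X x ⊎ Y x

_⊆_ : {V : Set} → Dataset V → Dataset V → Set
X ⊆ Y = ∀ x → X x → Y x

data Φ (V P : Set) : Set₁ where
  atom : P → Φ V P
  ~_   : Φ V P → Φ V P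
  _⇒_  : Φ V P → Φ V P → Φ V P
  B    : Dataset V → Dataset V → Φ V P → Φ V P   -- B T X φ  is  B^T_X φ
  [_]_ : Dataset V → Φ V P → Φ V P

infixr 5 _⇒_
infix 6 ~_
infixr 7 [_]_
infixl 9 _∪_

module _ {V P : Set} where

  infixr 4 _∧_
  infix 3 _⇔_

  _∧_ : Φ V P → Φ V P → Φ V P
  φ ∧ ψ = ~ (φ ⇒ ~ ψ)

  _⇔_ : Φ V P → Φ V P → Φ V P
  φ ⇔ ψ = (φ ⇒ ψ) ∧ (ψ ⇒ φ)

  pval : (Φ V P → Bool) → Φ V P → Bool
  pval v (atom p)  = v (atom p)
  pval v (~ φ)     = not (pval v φ)
  pval v (φ ⇒ ψ)   = not (pval v φ) ∨ pval v ψ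
  pval v (B T X φ) = v (B T X φ)
  pval v ([ X ] φ) = v ([ X ] φ)

  Tautology : Φ V P → Set₁
  Tautology φ = ∀ (v : Φ V P → Bool) → pval v φ ≡ true

  data Thm : Φ V P → Set₁ where
    taut    : ∀ {φ} → Tautology φ → Thm φ
    truth   : ∀ X φ → Thm (B ∅ X φ ⇒ φ)
    distB   : ∀ T X φ ψ → Thm (B T X (φ ⇒ ψ) ⇒ (B T X φ ⇒ B T X ψ))
    distA   : ∀ X φ ψ → Thm ([ X ] (φ ⇒ ψ) ⇒ ([ X ] φ ⇒ [ X ] ψ))
    negintr : ∀ T X φ → Thm (~ B T X φ ⇒ B ∅ X (~ B T X φ))
    mono    : ∀ T T' X X' φ → T ⊆ T' → X ⊆ X' → Thm (B T X φ ⇒ B T' X' φ)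
    trust   : ∀ T X Y φ → Thm (B T X (B T Y φ ⇒ φ))
    comb    : ∀ X Y φ → Thm ([ X ] ([ Y ] φ) ⇔ [ X ∪ Y ] φ)
    commut  : ∀ Y T X φ → Thm ([ Y ] B T X φ ⇔ B T (Y ∪ X) ([ Y ] φ))
    dual    : ∀ X φ → Thm (~ ([ X ] φ) ⇔ [ X ] (~ φ))
    empty   : ∀ φ → Thm ([ ∅ ] φ ⇔ φ)
    mp      : ∀ {φ ψ} → Thm (φ ⇒ ψ) → Thm φ → Thm ψ
    necB    : ∀ T X {φ} → Thm φ → Thm (B T X φ)
    necA    : ∀ X {φ} → Thm φ → Thm ([ X ] φ)

  FSet : Set₁
  FSet = Φ V P → Set

  data _⊢_ (F : FSet) : Φ V P → Set₁ where
    thm : ∀ {φ} → Thm φ → F ⊢ φ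
    hyp : ∀ {φ} → F φ → F ⊢ φ
    mp  : ∀ {φ ψ} → F ⊢ (φ ⇒ ψ) → F ⊢ φ → F ⊢ ψ

  Inconsistent : FSet → Set₁
  Inconsistent F = Σ (Φ V P) λ φ → (F ⊢ φ) × (F ⊢ (~ φ))

  Consistent : FSet → Set₁
  Consistent F = ¬ Inconsistent F

  _⊆F_ : FSet → FSet → Set₁
  F ⊆F G = ∀ φ → F φ → G φ

  MaxCons : FSet → Set₁
  MaxCons F = Consistent F × (∀ (G : FSet) → F ⊆F G → Consistent G → G ⊆F F)

  -- Canonical model M(T₀,F₀)
  -- A world T₀,F₀,X₁,T₁,F₁,…,Xₙ,Tₙ,Fₙ is represented by the list of
  -- steps (X₁,T₁,F₁) ∷ … ∷ (Xₙ,Tₙ,Fₙ) ∷ [] (T₀,F₀ are fixed).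

  Step : Set₁
  Step = Dataset V × Dataset V × FSet

  Seq : Set₁
  Seq = List Step

  CondB : Dataset V → FSet → Set₁
  CondB T F = ∀ (Y : Dataset V) (φ : Φ V P) → F (B T Y φ ⇒ φ)

  CondA : FSet → Dataset V → FSet → Set₁
  CondA F X F' = ∀ ψ → F (B ∅ X ψ) → F' ψ

  WfFrom : Dataset V → FSet → Seq → Set₁
  WfFrom T F []                  = MaxCons F × CondB T F
  WfFrom T F ((X , T' , F') ∷ s) = (MaxCons F × CondB T F) × CondA F X F' × WfFrom T' F' s

  IsWorld : Dataset V → FSet → Seq → Set₁
  IsWorld T₀ F₀ w = WfFrom T₀ F₀ w

  Tof : Dataset V → Seq → Dataset V
  Tof T₀ []              = T₀
  Tof T₀ ((_ , T , _) ∷ s) = Tof T s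

  Fof : FSet → Seq → FSet
  Fof F₀ []              = F₀
  Fof F₀ ((_ , _ , F) ∷ s) = Fof F s

  Labelled : V → Step → Set
  Labelled x (X , _ , _) = X x

  -- u ∼ₓ v : every edge on the simple path between u and v is labelled x.
  -- In the tree of sequences, the path goes from u up to the common
  -- ancestor c and down to v; its edges are those of su and sv where
  -- u = c ++ su and v = c ++ sv.
  _∼[_]_ : Seq → V → Seq → Set₁
  u ∼[ x ] v = Σ Seq λ c → Σ Seq λ su → Σ Seq λ sv →
                 (u ≡ c ++ su) × (v ≡ c ++ sv) ×
                 All (Labelled x) su × All (Labelled x) sv

  _∼⟨_⟩_ : Seq → Dataset V → Seq → Set₁
  u ∼⟨ X ⟩ v = ∀ x → X x → u ∼[ x ] v

-- Belief formulas B^T_X φ travel along every edge whose label contains X: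
-- downwards by positive introspection and condition (a), upwards by negative
-- introspection, condition (a) and consistency of the lower world.  The simple
-- path from w to u climbs to their last common ancestor and descends again,
-- each of its edges labelled by every x ∈ X, so B^T_X φ ∈ F(u); Monotonicity,
-- T ⊆ T(u) and condition (b) then put φ in F(u).  The last common ancestor
-- exists only classically (steps have no decidable equality), which suffices
-- because membership of a belief formula in such an F(u) is ¬¬-stable.
module Submission where

open import Defs
open import Data.Bool using (true; false; not; _∨_)
open import Data.Empty using (⊥-elim)
open import Data.Unit.Polymorphic using (⊤)
open import Data.Sum using (_⊎_; inj₁; inj₂)
open import Data.Product using (Σ; _×_; _,_; proj₁; proj₂)
open import Data.List using ([]; _∷_; _++_)
open import Data.List.Properties using (∷-injective)
open import Data.List.Relation.Unary.All as All using (All; []; _∷_)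
open import Data.List.Relation.Unary.All.Properties using (++⁻ʳ)
open import Relation.Binary.PropositionalEquality using (_≡_; _≢_; refl)
open import Relation.Nullary using (¬_; yes; no)
open import Relation.Nullary.Negation using (¬¬-map)
open import Relation.Nullary.Decidable using (¬¬-excluded-middle)
open import Function using (_∘_)

module _ {V : Set} {X : Dataset V} where

  ∅-⊆ : ∅ ⊆ X
  ∅-⊆ _ ()

  ⊆-refl : X ⊆ X
  ⊆-refl _ x = x

module _ {V P : Set} where

  private
    variable
      a b c ψ φ : Φ V P
      T T' X : Dataset V
      F G : FSet {V} {P}

  axiom-K : Thm (a ⇒ b ⇒ a)
  axiom-K {a} {b} = taut λ v → table (pval v a) (pval v b)
    where
      table : ∀ x y → not x ∨ (not y ∨ x) ≡ true
      table true  true  = refl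
      table true  false = refl
      table false _     = refl

  axiom-S : Thm ((a ⇒ b ⇒ c) ⇒ (a ⇒ b) ⇒ a ⇒ c)
  axiom-S {a} {b} {c} = taut λ v → table (pval v a) (pval v b) (pval v c)
    where
      table : ∀ x y z → not (not x ∨ (not y ∨ z)) ∨ (not (not x ∨ y) ∨ (not x ∨ z)) ≡ true
      table false _     _     = refl
      table true  false _     = refl
      table true  true  true  = refl
      table true  true  false = refl

  ¬-intro : Thm ((a ⇒ b) ⇒ (a ⇒ ~ b) ⇒ ~ a)
  ¬-intro {a} {b} = taut λ v → table (pval v a) (pval v b)
    where
      table : ∀ x y → not (not x ∨ y) ∨ (not (not x ∨ not y) ∨ not x) ≡ true
      table false _     = refl
      table true  true  = refl
      table true  false = refl

  syllogism : Thm ((a ⇒ b) ⇒ (b ⇒ c) ⇒ a ⇒ c)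
  syllogism {a} {b} {c} = taut λ v → table (pval v a) (pval v b) (pval v c)
    where
      table : ∀ x y z → not (not x ∨ y) ∨ (not (not y ∨ z) ∨ (not x ∨ z)) ≡ true
      table true  false _     = refl
      table true  true  true  = refl
      table true  true  false = refl
      table false false _     = refl
      table false true  true  = refl
      table false true  false = refl

  contraposition : Thm ((a ⇒ b) ⇒ ~ b ⇒ ~ a)
  contraposition {a} {b} = taut λ v → table (pval v a) (pval v b)
    where
      table : ∀ x y → not (not x ∨ y) ∨ (not (not y) ∨ not x) ≡ true
      table true  true  = refl
      table true  false = refl
      table false true  = refl
      table false false = refl

  contraposition-~ˡ : Thm ((~ a ⇒ b) ⇒ ~ b ⇒ a)
  contraposition-~ˡ {a} {b} = taut λ v → table (pval v a) (pval v b)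
    where
      table : ∀ x y → not (not (not x) ∨ y) ∨ (not (not y) ∨ x) ≡ true
      table true  true  = refl
      table true  false = refl
      table false true  = refl
      table false false = refl

  contraposition-~ʳ : Thm ((a ⇒ ~ b) ⇒ b ⇒ ~ a)
  contraposition-~ʳ {a} {b} = taut λ v → table (pval v a) (pval v b)
    where
      table : ∀ x y → not (not x ∨ not y) ∨ (not y ∨ not x) ≡ true
      table true  true  = refl
      table true  false = refl
      table false true  = refl
      table false false = refl

  infixr 4 _⇒-trans_

  _⇒-trans_ : Thm (a ⇒ b) → Thm (b ⇒ c) → Thm (a ⇒ c)
  t ⇒-trans u = mp (mp syllogism t) u

  B-map : Thm (a ⇒ b) → Thm (B T X a ⇒ B T X b)
  B-map {T = T} {X} t = mp (distB T X _ _) (necB T X t)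

  deduction : (∀ {ψ} → G ψ → F ⊢ (a ⇒ ψ)) → G ⊢ φ → F ⊢ (a ⇒ φ)
  deduction h (thm t)  = mp (thm axiom-K) (thm t)
  deduction h (hyp g)  = h g
  deduction h (mp d e) = mp (mp (thm axiom-S) (deduction h d)) (deduction h e)

  -- β → ~ B(~ β) → B(~ B(~ β)) → B β for B = B^∅_X, by Truth, Negative
  -- Introspection, and Negative Introspection for β under B; then Monotonicity.
  positive-introspection : ∀ {T X T' X' : Dataset V} {φ : Φ V P} → X ⊆ X' →
                           Thm (B T X φ ⇒ B T' X' (B T X φ))
  positive-introspection {T} {X} {T'} {X'} {φ} X⊆X' =
    mp contraposition-~ʳ (truth X (~ β))
      ⇒-trans negintr ∅ X (~ β)
      ⇒-trans B-map (mp contraposition-~ˡ (negintr T X φ))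
      ⇒-trans mono ∅ T' X X' β ∅-⊆ X⊆X'
    where
      β : Φ V P
      β = B T X φ

  negative-introspection : ∀ {T X T' X' : Dataset V} {φ : Φ V P} → X ⊆ X' →
                           Thm (~ B T X φ ⇒ B T' X' (~ B T X φ))
  negative-introspection {T} {X} {T'} {X'} {φ} X⊆X' =
    negintr T X φ ⇒-trans mono ∅ T' X X' (~ B T X φ) ∅-⊆ X⊆X'

  module MaxConsistent (maxCons : MaxCons F) where

    consistent : Consistent F
    consistent = proj₁ maxCons

    -- Formulas contain datasets V → Set, so "ψ is this formula" is not a
    -- Set-valued predicate and F cannot be extended by a single formula; the
    -- consequents of a in F, consistent with F by the deduction theorem, serve.
    discharge : ¬ (F ⊢ (~ a)) → F (a ⇒ ψ) → F ψ
    discharge {a} ¬⊢~a a⇒ψ = proj₂ maxCons Fₐ (λ _ → inj₁) Fₐ-consistent _ (inj₂ a⇒ψ)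
      where
        Fₐ : FSet
        Fₐ ψ = F ψ ⊎ F (a ⇒ ψ)

        assuming-a : ∀ {ψ} → Fₐ ψ → F ⊢ (a ⇒ ψ)
        assuming-a (inj₁ f)   = mp (thm axiom-K) (hyp f)
        assuming-a (inj₂ a⇒f) = hyp a⇒f

        Fₐ-consistent : Consistent Fₐ
        Fₐ-consistent (ψ , d , e) =
          ¬⊢~a (mp (mp (thm ¬-intro) (deduction assuming-a d)) (deduction assuming-a e))

    mp-closed : F a → F (a ⇒ b) → F b
    mp-closed f = discharge λ d → consistent (_ , hyp f , d)

  module Node (maxCons : MaxCons F) (condB : CondB T F) where

    open MaxConsistent maxCons

    -- Condition (b) gives B^T_X β ⇒ β ∈ F, and by introspection B^T_X β is
    -- consistent with F whenever β is.
    B-closed : ∀ {T' X φ} → ¬ (F ⊢ (~ B T' X φ)) → F (B T' X φ)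
    B-closed {T'} {X} {φ} ¬⊢~β =
      discharge (λ d → ¬⊢~β (mp (thm (mp contraposition (positive-introspection ⊆-refl))) d))
                (condB X (B T' X φ))

    B-closed-⊢ : ∀ {T' X φ} → F ⊢ B T' X φ → F (B T' X φ)
    B-closed-⊢ d = B-closed λ e → consistent (_ , d , e)

    B-stable : ∀ {T' X φ} → ¬ ¬ F (B T' X φ) → F (B T' X φ)
    B-stable ¬¬f = B-closed λ d → ¬¬f λ f → consistent (_ , hyp f , d)

    module _ {X' : Dataset V} {F' : FSet} (condA : CondA F X' F')
             {T' X : Dataset V} {φ : Φ V P} (X⊆X' : X ⊆ X') where

      B-descends : F (B T' X φ) → F' (B T' X φ)
      B-descends f = condA _ (B-closed-⊢ (mp (thm (positive-introspection X⊆X')) (hyp f)))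

      B-ascends : Consistent F' → F' (B T' X φ) → F (B T' X φ)
      B-ascends consistent' f' = B-closed λ d →
        consistent' (_ , hyp f' , hyp (condA _ (B-closed-⊢ (mp (thm (negative-introspection X⊆X')) d))))

  LabelledBy : Dataset V → Step {V} {P} → Set
  LabelledBy X step = ∀ x → X x → Labelled x step

  WfFrom-consistent : (s : Seq) → WfFrom T F s → Consistent F
  WfFrom-consistent []      ((consistent , _) , _)     = consistent
  WfFrom-consistent (_ ∷ _) (((consistent , _) , _) , _) = consistent

  WfFrom-last : (s : Seq) → WfFrom T F s → MaxCons (Fof F s) × CondB (Tof T s) (Fof F s)
  WfFrom-last []      node         = node
  WfFrom-last (_ ∷ s) (_ , _ , wf) = WfFrom-last s wf

  B-descends-along : (s : Seq) → WfFrom T F s → All (LabelledBy X) s →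
                     F (B T' X φ) → Fof F s (B T' X φ)
  B-descends-along []      _                                  []       f = f
  B-descends-along (_ ∷ s) ((maxCons , condB) , condA , wf) (l ∷ ls) f =
    B-descends-along s wf ls (Node.B-descends maxCons condB condA l f)

  B-ascends-along : (s : Seq) → WfFrom T F s → All (LabelledBy X) s →
                    Fof F s (B T' X φ) → F (B T' X φ)
  B-ascends-along []      _                                  []       f = f
  B-ascends-along (_ ∷ s) ((maxCons , condB) , condA , wf) (l ∷ ls) f =
    Node.B-ascends maxCons condB condA l (WfFrom-consistent s wf) (B-ascends-along s wf ls f)

  Diverge : Seq {V} {P} → Seq {V} {P} → Set₁
  Diverge (s ∷ _) (t ∷ _) = s ≢ t
  Diverge _       _       = ⊤

  data Fork : Seq {V} {P} → Seq {V} {P} → Set₁ where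
    fork : (c sw su : Seq) → Diverge sw su → Fork (c ++ sw) (c ++ su)

  fork-∷ : ∀ {w u} (s : Step) → Fork w u → Fork (s ∷ w) (s ∷ u)
  fork-∷ s (fork c sw su div) = fork (s ∷ c) sw su div

  ¬¬-fork : (w u : Seq) → ¬ ¬ Fork w u
  ¬¬-fork []      u       k = k (fork [] [] u _)
  ¬¬-fork (s ∷ w) []      k = k (fork [] (s ∷ w) [] _)
  ¬¬-fork (s ∷ w) (t ∷ u) k = ¬¬-excluded-middle {A = s ≡ t} λ where
    (yes refl) → ¬¬-fork w u (k ∘ fork-∷ s)
    (no s≢t) → k (fork [] (s ∷ w) (t ∷ u) s≢t)

  common-prefix-above-fork : (c cx : Seq) {sw su a b : Seq} →
                             c ++ sw ≡ cx ++ a → c ++ su ≡ cx ++ b → Diverge sw su →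
                             Σ Seq λ d → a ≡ d ++ sw × b ≡ d ++ su
  common-prefix-above-fork c       []       refl refl _   = c , refl , refl
  common-prefix-above-fork []      (_ ∷ _)  refl refl div = ⊥-elim (div refl)
  common-prefix-above-fork (_ ∷ c) (_ ∷ cx) e₁   e₂   div =
    common-prefix-above-fork c cx (proj₂ (∷-injective e₁)) (proj₂ (∷-injective e₂)) div

  fork-branches-labelled : ∀ {x} (c : Seq) {sw su} → Diverge sw su → (c ++ sw) ∼[ x ] (c ++ su) →
                           All (Labelled x) sw × All (Labelled x) su
  fork-branches-labelled c div (cx , _ , _ , e₁ , e₂ , la , lb)
    with common-prefix-above-fork c cx e₁ e₂ div
  ... | d , refl , refl = ++⁻ʳ d la , ++⁻ʳ d lb

  fork-branches-labelledBy : (c : Seq) {sw su : Seq} → Diverge sw su → (c ++ sw) ∼⟨ X ⟩ (c ++ su) →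
                             All (LabelledBy X) sw × All (LabelledBy X) su
  fork-branches-labelledBy c div sim =
    All.tabulate (λ e x x∈X → All.lookup (proj₁ (fork-branches-labelled c div (sim x x∈X))) e) ,
    All.tabulate (λ e x x∈X → All.lookup (proj₂ (fork-branches-labelled c div (sim x x∈X))) e)

  B-transfer-below : (c : Seq) {sw su : Seq} → WfFrom T F (c ++ sw) → WfFrom T F (c ++ su) →
                     All (LabelledBy X) sw → All (LabelledBy X) su →
                     Fof F (c ++ sw) (B T' X φ) → Fof F (c ++ su) (B T' X φ)
  B-transfer-below []      {sw} {su} wf-w wf-u lw lu =
    B-descends-along su wf-u lu ∘ B-ascends-along sw wf-w lw
  B-transfer-below (_ ∷ c) (_ , _ , wf-w) (_ , _ , wf-u) = B-transfer-below c wf-w wf-u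

  B-transfer : {w u : Seq} → Fork w u → WfFrom T F w → WfFrom T F u → w ∼⟨ X ⟩ u →
               Fof F w (B T' X φ) → Fof F u (B T' X φ)
  B-transfer (fork c sw su div) wf-w wf-u sim =
    B-transfer-below c wf-w wf-u (proj₁ labelled) (proj₂ labelled)
    where labelled = fork-branches-labelledBy c div sim

open MaxConsistent using (mp-closed)
open Node using (B-closed-⊢; B-stable)

lemma8 : {V P : Set} (T₀ : Dataset V) (F₀ : FSet {V} {P}) → MaxCons F₀ →
         (w u : Seq {V} {P}) → IsWorld T₀ F₀ w → IsWorld T₀ F₀ u →
         (T X : Dataset V) (φ : Φ V P) →
         Fof F₀ w (B T X φ) → w ∼⟨ X ⟩ u → T ⊆ Tof T₀ u →
         Fof F₀ u φ
-- MaxCons F₀ is also part of IsWorld.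
lemma8 T₀ F₀ _ w u world-w world-u T X φ Bw w∼u T⊆Tu with WfFrom-last u world-u
... | maxCons , condB = mp-closed maxCons (B-closed-⊢ maxCons condB B-Tu) (condB X φ)
  where
    Bu : Fof F₀ u (B T X φ)
    Bu = B-stable maxCons condB (¬¬-map (λ fk → B-transfer fk world-w world-u w∼u Bw) (¬¬-fork w u))

    B-Tu : Fof F₀ u ⊢ B (Tof T₀ u) X φ
    B-Tu = mp (thm (mono T (Tof T₀ u) X X φ T⊆Tu ⊆-refl)) (hyp Bu)
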